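{- Every graph $G$ and every neighborhood system $\Sigma$ for $G$ satisfy $\chi(\Sigma)\le \chi_s(G)^2\,\rho(\Sigma)$.
   Context: Graphs are finite and simple. For a graph $G=(V,E)$, a neighborhood system for $G$ is a collection $(\Sigma(v))_{v\in V}$ with $\Sigma(v)\subseteq N(v)$ (the set of neighbors of $v$). A $\Sigma$-coloring is a coloring of $V$ in which any two distinct vertices lying together in some $\Sigma(w)$ get different colors; $\chi(\Sigma)$ is the minimum number of colors of a $\Sigma$-coloring, and $\rho(\Sigma)=\max_{v}|\Sigma(v)|$. $\chi_s(G)$ is the star chromatic number of $G$: the least number of colors in a proper coloring of $G$ in which every two color classes induce a forest of stars. -}

module Defs where

open import Data.Nat using (ℕ; _⊔_)
open import Data.Fin using (Fin)
open import Data.Fin.Subset using (Subset; _∈_; ∣_∣)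
open import Data.Vec using (tabulate; foldr′)
open import Data.Product using (Σ; _×_)
open import Data.Sum using (_⊎_)
open import Relation.Binary.PropositionalEquality using (_≡_; _≢_)
open import Relation.Nullary using (¬_)

record Graph : Set₁ where
  field
    n      : ℕ
    Adj    : Fin n → Fin n → Set
    sym    : ∀ {u v} → Adj u v → Adj v u
    irrefl : ∀ {v} → ¬ Adj v v

module _ (G : Graph) where
  open Graph G

  record NeighborhoodSystem : Set where
    field
      nbh   : Fin n → Subset n
      nbh⊆N : ∀ v u → u ∈ nbh v → Adj v u

  ρ : NeighborhoodSystem → ℕ
  ρ S = foldr′ _⊔_ 0 (tabulate (λ v → ∣ NeighborhoodSystem.nbh S v ∣))

  IsΣColoring : (S : NeighborhoodSystem) {k : ℕ} → (Fin n → Fin k) → Set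
  IsΣColoring S c = ∀ w x y → x ∈ NeighborhoodSystem.nbh S w → y ∈ NeighborhoodSystem.nbh S w
                    → x ≢ y → c x ≢ c y

  IsProper : {k : ℕ} → (Fin n → Fin k) → Set
  IsProper c = ∀ x y → Adj x y → c x ≢ c y

  -- The subgraph of G induced by the vertex set {x | P x} is a forest of stars:
  -- it is a disjoint union of stars, witnessed by assigning to every vertex x
  -- (of the set) the center z x of its star; centers are their own centers
  -- (an isolated vertex is a one-vertex star), each leaf is adjacent to its
  -- center, and every edge of the induced subgraph joins a leaf to its center.
  IsStarForest : (Fin n → Set) → Set
  IsStarForest P =
    Σ (Fin n → Fin n) λ z →
      (∀ x → P x → P (z x)) ×
      (∀ x → P x → z (z x) ≡ z x) ×
      (∀ x → P x → x ≢ z x → Adj x (z x)) ×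
      (∀ x y → P x → P y → Adj x y →
         (y ≡ z x × x ≢ z x) ⊎ (x ≡ z y × y ≢ z y))

  IsStarColoring : {k : ℕ} → (Fin n → Fin k) → Set
  IsStarColoring {k} c =
    IsProper c × (∀ (i j : Fin k) → i ≢ j → IsStarForest (λ x → (c x ≡ i) ⊎ (c x ≡ j)))

module Submission where

-- Let c be a star colouring of G with k colours.  Two distinct vertices x, y
-- are in conflict if c x ≡ c y and they lie in a common Σ(w); the colouring
-- x ↦ (c x , g x) is a Σ-colouring as soon as g separates conflicting vertices.
-- If x conflicts with y through w, then c w ≢ c x (c is proper), and in the
-- star forest of the colours c x, c w the vertex w has two distinct
-- neighbours x, y, so w is the centre of x's star.  Hence all conflict
-- partners of x lie in the k - 1 sets Σ(centre of x for colour b), b ≢ c x,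
-- listed by a list of length ≤ (k - 1) ρ < k ρ.  Greedy colouring then gives
-- g with k ρ colours, and pairing with c gives k · k ρ colours.

open import Defs
open import Data.Nat using (ℕ; zero; suc; _*_; _≤_; _<_; _⊔_; z≤n; s≤s)
import Data.Nat.Properties as ℕₚ
open import Data.Fin using (Fin; toℕ; punchIn; punchOut; combine; cast)
import Data.Fin as F
import Data.Fin.Properties as Finₚ
open import Data.Fin.Subset using (Subset; inside; outside; ∣_∣)
import Data.Fin.Subset as Subset
open import Data.Vec using ([]; _∷_; tabulate; foldr′; here; there)
open import Data.Vec.Functional using (updateAt)
open import Data.Vec.Functional.Properties using (updateAt-updates; updateAt-minimal)
open import Data.List using (List; length; map; _++_; allFin)
import Data.List as List
import Data.List.Properties as Listₚ
open import Data.List.Relation.Unary.Any using (index)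
import Data.List.Relation.Unary.Any as Any
open import Data.List.Relation.Unary.Any.Properties using (lookup-index)
open import Data.List.Membership.Propositional using (_∈_; _∉_)
open import Data.List.Membership.Propositional.Properties using (∈-map⁺; ∈-++⁺ˡ; ∈-++⁺ʳ; ∈-allFin)
import Data.List.Membership.DecPropositional as DecMembership
open import Data.Product using (Σ; _×_; _,_; proj₁; proj₂; ∃)
open import Data.Sum using (_⊎_; inj₁; inj₂)
open import Data.Empty using (⊥-elim)
open import Relation.Nullary using (¬_; yes; no; Dec)
open import Relation.Binary.PropositionalEquality
open import Function using (const)

-- Pigeonhole: a list of fewer than N elements of Fin N misses some element.
-- (Otherwise the positions in the list would inject Fin N into Fin (length xs).)
short-list-misses : ∀ {N} (xs : List (Fin N)) → length xs < N → ∃ λ ℓ → ℓ ∉ xs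
short-list-misses {N} xs short =
  Finₚ.¬∀⟶∃¬ N (_∈ xs) (_∈? xs) not-all
  where
  open DecMembership (Finₚ._≟_ {N}) using (_∈?_)
  not-all : ¬ (∀ ℓ → ℓ ∈ xs)
  not-all all with Finₚ.pigeonhole short (λ ℓ → index (all ℓ))
  ... | i , j , i<j , same-index = ℕₚ.<⇒≢ i<j (cong toℕ (begin
    i                              ≡⟨ lookup-index (all i) ⟩
    List.lookup xs (index (all i)) ≡⟨ cong (List.lookup xs) same-index ⟩
    List.lookup xs (index (all j)) ≡⟨ lookup-index (all j) ⟨
    j                              ∎))
    where open ≡-Reasoning

elements : ∀ {n} → Subset n → List (Fin n)
elements []            = List.[]
elements (outside ∷ p) = map F.suc (elements p)
elements (inside ∷ p)  = F.zero List.∷ map F.suc (elements p)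

length-elements : ∀ {n} (p : Subset n) → length (elements p) ≤ ∣ p ∣
length-elements [] = z≤n
length-elements (outside ∷ p) rewrite Listₚ.length-map F.suc (elements p) = length-elements p
length-elements (inside ∷ p)  rewrite Listₚ.length-map F.suc (elements p) = s≤s (length-elements p)

∈-elements : ∀ {n} (p : Subset n) {y} → y Subset.∈ p → y ∈ elements p
∈-elements (inside ∷ p)  here      = Any.here refl
∈-elements (outside ∷ p) (there m) = ∈-map⁺ F.suc (∈-elements p m)
∈-elements (inside ∷ p)  (there m) = Any.there (∈-map⁺ F.suc (∈-elements p m))

concatFin : ∀ {A : Set} k → (Fin k → List A) → List A
concatFin zero    f = List.[]
concatFin (suc k) f = f F.zero ++ concatFin k (λ i → f (F.suc i))

length-concatFin : ∀ {A : Set} k (f : Fin k → List A) r →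
                   (∀ i → length (f i) ≤ r) → length (concatFin k f) ≤ k * r
length-concatFin zero    f r bound = z≤n
length-concatFin (suc k) f r bound rewrite Listₚ.length-++ (f F.zero) {concatFin k (λ i → f (F.suc i))} =
  ℕₚ.+-mono-≤ (bound F.zero) (length-concatFin k (λ i → f (F.suc i)) r (λ i → bound (F.suc i)))

∈-concatFin : ∀ {A : Set} k (f : Fin k → List A) i {y} → y ∈ f i → y ∈ concatFin k f
∈-concatFin (suc k) f F.zero    y∈ = ∈-++⁺ˡ y∈
∈-concatFin (suc k) f (F.suc i) y∈ = ∈-++⁺ʳ (f F.zero) (∈-concatFin k (λ i → f (F.suc i)) i y∈)

≤-max : ∀ {m} (f : Fin m → ℕ) i → f i ≤ foldr′ _⊔_ 0 (tabulate f)
≤-max f F.zero    = ℕₚ.m≤m⊔n _ _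
≤-max f (F.suc i) = ℕₚ.≤-trans (≤-max (λ j → f (F.suc j)) i) (ℕₚ.m≤n⊔m (f F.zero) _)

module Greedy {n N : ℕ} (R : Fin n → Fin n → Set)
  (R-sym : ∀ {x y} → R x y → R y x) (R-irrefl : ∀ {x} → ¬ R x x)
  (nbrs : Fin n → List (Fin n)) (short : ∀ v → length (nbrs v) < N)
  (nbrs-complete : ∀ {v y} → R v y → y ∈ nbrs v) where

  ProperOn : List (Fin n) → (Fin n → Fin N) → Set
  ProperOn vs g = ∀ {x y} → x ∈ vs → y ∈ vs → R x y → g x ≢ g y

  ∈-tail : ∀ {x v} {vs : List (Fin n)} → x ∈ v List.∷ vs → x ≢ v → x ∈ vs
  ∈-tail (Any.here x≡v) x≢v = ⊥-elim (x≢v x≡v)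
  ∈-tail (Any.there x∈) _   = x∈

  extend : ∀ {v vs g ℓ} → ProperOn vs g → ℓ ∉ map g (nbrs v) →
           ProperOn (v List.∷ vs) (updateAt g v (const ℓ))
  extend {v} {vs} {g} {ℓ} proper ℓ-free {x} {y} x∈ y∈ xRy = by-cases (x Finₚ.≟ v) (y Finₚ.≟ v)
    where
    g′ : Fin n → Fin N
    g′ = updateAt g v (const ℓ)
    fresh : ∀ {u} → R v u → u ≢ v → g′ u ≢ ℓ
    fresh vRu u≢v same = ℓ-free (subst (_∈ map g (nbrs v))
      (trans (sym (updateAt-minimal _ v g u≢v)) same) (∈-map⁺ g (nbrs-complete vRu)))
    by-cases : Dec (x ≡ v) → Dec (y ≡ v) → g′ x ≢ g′ y
    by-cases (yes refl) (yes refl) _ = R-irrefl xRy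
    by-cases (yes refl) (no y≢v) e =
      fresh xRy y≢v (trans (sym e) (updateAt-updates v g))
    by-cases (no x≢v) (yes refl) e =
      fresh (R-sym xRy) x≢v (trans e (updateAt-updates v g))
    by-cases (no x≢v) (no y≢v) e = proper (∈-tail x∈ x≢v) (∈-tail y∈ y≢v) xRy
      (trans (sym (updateAt-minimal _ v g x≢v)) (trans e (updateAt-minimal _ v g y≢v)))

  -- An arbitrary initial colouring (N > 0 since every list is shorter than N).
  initial : Fin n → Fin N
  initial v = F.fromℕ< (ℕₚ.≤-trans (s≤s z≤n) (short v))

  colour-list : (vs : List (Fin n)) → Σ (Fin n → Fin N) (ProperOn vs)
  colour-list List.[]       = initial , λ ()
  colour-list (v List.∷ vs) with colour-list vs
  ... | g , proper with short-list-misses (map g (nbrs v))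
                         (subst (_< N) (sym (Listₚ.length-map g (nbrs v))) (short v))
  ... | ℓ , ℓ-free = updateAt g v (const ℓ) , extend proper ℓ-free

  greedy : Σ (Fin n → Fin N) λ g → ∀ x y → R x y → g x ≢ g y
  greedy with colour-list (allFin n)
  ... | g , proper = g , λ x y → proper (∈-allFin x) (∈-allFin y)

module _ (G : Graph) where
  open Graph G renaming (sym to Adj-sym)

  -- In a forest of stars on P, if a vertex w of P is adjacent to two distinct
  -- vertices v, y of P, then w is the centre of v's star: a leaf has only
  -- one neighbour, so w is a centre and v one of its leaves.
  common-neighbour-is-centre : ∀ {P} (F : IsStarForest G P) {v y w} →
    P v → P y → P w → v ≢ y → Adj w v → Adj w y → proj₁ F v ≡ w
  common-neighbour-is-centre (z , _ , idem , _ , edge) {v} {y} {w} Pv Py Pw v≢y wv wy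
    with edge v w Pv Pw (Adj-sym wv)
  ... | inj₁ (w≡zv , _) = sym w≡zv
  ... | inj₂ (v≡zw , w≢zw) with edge w y Pw Py wy
  ...   | inj₁ (y≡zw , _) = ⊥-elim (v≢y (trans v≡zw (sym y≡zw)))
  ...   | inj₂ (w≡zy , _) = ⊥-elim (w≢zw (sym (begin
    z w     ≡⟨ cong z w≡zy ⟩
    z (z y) ≡⟨ idem y Py ⟩
    z y     ≡⟨ w≡zy ⟨
    w       ∎)))
    where open ≡-Reasoning

  module StarColouring (S : NeighborhoodSystem G) {k : ℕ}
    (c : Fin n → Fin (suc k)) (star-colouring : IsStarColoring G c) where
    open NeighborhoodSystem S

    Conflict : Fin n → Fin n → Set
    Conflict x y = x ≢ y × c x ≡ c y × ∃ λ w → x Subset.∈ nbh w × y Subset.∈ nbh w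

    conflict-sym : ∀ {x y} → Conflict x y → Conflict y x
    conflict-sym (x≢y , same , w , x∈ , y∈) = (λ y≡x → x≢y (sym y≡x)) , sym same , w , y∈ , x∈

    conflict-irrefl : ∀ {x} → ¬ Conflict x x
    conflict-irrefl (x≢x , _) = x≢x refl

    other : Fin n → Fin k → Fin (suc k)
    other v b = punchIn (c v) b

    forest : ∀ v b → IsStarForest G (λ x → (c x ≡ c v) ⊎ (c x ≡ other v b))
    forest v b = proj₂ star-colouring (c v) (other v b) (λ e → Finₚ.punchInᵢ≢i (c v) b (sym e))

    centre : Fin n → Fin k → Fin n
    centre v b = proj₁ (forest v b) v

    candidates : Fin n → List (Fin n)
    candidates v = concatFin k (λ b → elements (nbh (centre v b)))

    length-candidates : ∀ v → length (candidates v) ≤ k * ρ G S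
    length-candidates v = length-concatFin k _ (ρ G S) λ b →
      ℕₚ.≤-trans (length-elements (nbh (centre v b))) (≤-max (λ u → ∣ nbh u ∣) (centre v b))

    -- If v conflicts with y through w, then c w ≢ c v (c is proper), so
    -- c w = other v b for some b, and w is the centre of v in that forest.
    conflict⇒candidate : ∀ {v y} → Conflict v y → y ∈ candidates v
    conflict⇒candidate {v} {y} (v≢y , same , w , v∈ , y∈) =
      ∈-concatFin k _ b (∈-elements (nbh (centre v b)) (subst (λ u → y Subset.∈ nbh u) (sym centre≡w) y∈))
      where
      wv : Adj w v
      wv = nbh⊆N w v v∈
      cv≢cw : c v ≢ c w
      cv≢cw e = proj₁ star-colouring w v wv (sym e)
      b : Fin k
      b = punchOut cv≢cw
      centre≡w : centre v b ≡ w
      centre≡w = common-neighbour-is-centre (forest v b) (inj₁ refl) (inj₁ (sym same))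
        (inj₂ (sym (Finₚ.punchIn-punchOut cv≢cw))) v≢y wv (nbh⊆N w y y∈)

cast-injective : ∀ {a b} .(eq : a ≡ b) {i j : Fin a} → cast eq i ≡ cast eq j → i ≡ j
cast-injective eq {i} {j} e = Finₚ.toℕ-injective (begin
  toℕ i           ≡⟨ Finₚ.toℕ-cast eq i ⟨
  toℕ (cast eq i) ≡⟨ cong toℕ e ⟩
  toℕ (cast eq j) ≡⟨ Finₚ.toℕ-cast eq j ⟩
  toℕ j           ∎)
  where open ≡-Reasoning

lemma5 : (G : Graph) (S : NeighborhoodSystem G) → 1 ≤ ρ G S →
    (k : ℕ) (c : Fin (Graph.n G) → Fin k) → IsStarColoring G c →
    Σ (Fin (Graph.n G) → Fin (k * k * ρ G S)) λ c′ → IsΣColoring G S c′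
lemma5 G S ρ≥1 zero    c _ = c , λ _ x _ _ _ _ _ → Finₚ.¬Fin0 (c x)
lemma5 G S ρ≥1 (suc k) c star-colouring = paired , paired-separates
  where
  open StarColouring G S c star-colouring
  r : ℕ
  r = ρ G S

  -- (k - 1) ρ < k ρ because ρ ≥ 1; here k is suc k.
  few-candidates : ∀ v → length (candidates v) < suc k * r
  few-candidates v = ℕₚ.≤-trans (s≤s (length-candidates v)) (ℕₚ.+-monoˡ-≤ (k * r) ρ≥1)
  open Greedy Conflict conflict-sym conflict-irrefl candidates few-candidates conflict⇒candidate


  g : Fin (Graph.n G) → Fin (suc k * r)
  g = proj₁ greedy

  reassociate : suc k * (suc k * r) ≡ suc k * suc k * r
  reassociate = sym (ℕₚ.*-assoc (suc k) (suc k) r)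

  paired : Fin (Graph.n G) → Fin (suc k * suc k * r)
  paired x = cast reassociate (combine (c x) (g x))

  paired-separates : IsΣColoring G S paired
  paired-separates w x y x∈ y∈ x≢y e
    with Finₚ.combine-injective (c x) (g x) (c y) (g y) (cast-injective reassociate e)
  ... | same-c , same-g = proj₂ greedy x y (x≢y , same-c , w , x∈ , y∈) same-g
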